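{- Let $T$ be a tree, $xy$ an edge of $T$, and $x'$ a vertex distinct from $x$ in the component of $T-xy$ containing $x$; let $\rho(T) = (T - yx) + yx'$. Let $z$ (resp. $z'$) be the neighbor of $x$ (resp. $x'$) on the unique $xx'$-path in $T$ (so $z=x'$, $z'=x$ if $xx'\in E(T)$). Let $x_1,\dots,x_\ell$ be the neighbors of $x$ other than $z$ and $y$, and $x'_1,\dots,x'_{\ell'}$ the neighbors of $x'$ other than $z'$. For $v\in V(T)\setminus\{x,x'\}$ let $T_v$ be the component of $T-\{x,x'\}$ containing $v$, and let $T_v$ be the empty tree if $v\in\{x,x'\}$. Define $X=\prod_{i=1}^{\ell}F(T_{x_i})$, $\overline X=\prod_{i=1}^{\ell}F(T_{x_i}-x_i)$, $X'=\prod_{i=1}^{\ell'}F(T_{x'_i})$, $\overline X'=\prod_{i=1}^{\ell'}F(T_{x'_i}-x'_i)$, $\overline Z_z = F(T_z - z)$, $\overline Z_{z'} = F(T_z - z')$, with the conventions that empty products equal $1$ and $\overline Z_z=\overline Z_{z'}=1$ if $x$ is adjacent to $x'$. Then $F(\rho(T)) < F(T)$ if and only if $X\,\overline X'\,\overline Z_{z'} > \overline X\, X'\,\overline Z_z$.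
   Context: $F(G)$ denotes the number of stable sets of a graph $G$, including the empty set; the empty graph has $F=1$. -}

module Defs where

open import Data.Nat using (ℕ; zero; suc; _+_; _*_; _≤_)
open import Data.Bool using (Bool; true; false; _∧_; _∨_; not; if_then_else_)
open import Data.Fin using (Fin; zero; suc)
open import Data.Fin.Properties using (_≟_)
open import Data.Vec using (Vec; []; _∷_; lookup)
open import Data.List using (List; []; _∷_; _++_; map; length; foldr)
open import Data.List.Relation.Unary.Unique.Propositional using (Unique)
open import Data.Product using (Σ; _×_; _,_; ∃)
open import Data.Empty using (⊥)
open import Relation.Nullary using (¬_; does)
open import Relation.Binary.PropositionalEquality using (_≡_; _≢_)

Graph : ℕ → Set
Graph n = Fin n → Fin n → Bool

IsSimple : ∀ {n} → Graph n → Set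
IsSimple {n} G = (∀ u v → G u v ≡ G v u) × (∀ v → G v v ≡ false)

_==_ : ∀ {n} → Fin n → Fin n → Bool
u == v = does (u ≟ v)

data IsWalk {n} (G : Graph n) : List (Fin n) → Set where
  single : ∀ v → IsWalk G (v ∷ [])
  step   : ∀ {u w ws} → G u w ≡ true → IsWalk G (w ∷ ws) → IsWalk G (u ∷ w ∷ ws)

lastOf : ∀ {n} → Fin n → List (Fin n) → Fin n
lastOf v [] = v
lastOf v (w ∷ ws) = lastOf w ws

IsPath : ∀ {n} → Graph n → Fin n → Fin n → List (Fin n) → Set
IsPath G u v ps = Σ (List _) λ rest → (ps ≡ u ∷ rest) × (lastOf u rest ≡ v) × IsWalk G ps × Unique ps

Reach : ∀ {n} → Graph n → Fin n → Fin n → Set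
Reach G u v = Σ (List _) λ rest → IsWalk G (u ∷ rest) × (lastOf u rest ≡ v)

Connected : ∀ {n} → Graph n → Set
Connected G = ∀ u v → Reach G u v

IsCycle : ∀ {n} → Graph n → List (Fin n) → Set
IsCycle G [] = ⊥
IsCycle G (_ ∷ []) = ⊥
IsCycle G (_ ∷ _ ∷ []) = ⊥
IsCycle G (v₀ ∷ v₁ ∷ v₂ ∷ vs) =
  IsWalk G (v₀ ∷ v₁ ∷ v₂ ∷ vs) × Unique (v₀ ∷ v₁ ∷ v₂ ∷ vs) × (G (lastOf v₂ vs) v₀ ≡ true)

Acyclic : ∀ {n} → Graph n → Set
Acyclic G = ∀ cs → ¬ IsCycle G cs

IsTree : ∀ {n} → Graph n → Set
IsTree G = IsSimple G × Connected G × Acyclic G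

deleteEdge : ∀ {n} → Graph n → Fin n → Fin n → Graph n
deleteEdge G a b u v =
  if (u == a ∧ v == b) ∨ (u == b ∧ v == a) then false else G u v

addEdge : ∀ {n} → Graph n → Fin n → Fin n → Graph n
addEdge G a b u v =
  if (u == a ∧ v == b) ∨ (u == b ∧ v == a) then true else G u v

-- G − {a, b} (vertices a, b made isolated; walks starting outside {a,b}
-- are exactly the walks of the vertex-deleted graph).
deleteVertices : ∀ {n} → Graph n → Fin n → Fin n → Graph n
deleteVertices G a b u v =
  if u == a ∨ u == b ∨ v == a ∨ v == b then false else G u v

rho : ∀ {n} → Graph n → (x y x' : Fin n) → Graph n
rho T x y x' = addEdge (deleteEdge T y x) y x'

subsets : ∀ n → List (Vec Bool n)
subsets zero = [] ∷ []
subsets (suc n) = map (false ∷_) (subsets n) ++ map (true ∷_) (subsets n)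

allFin : ∀ n → List (Fin n)
allFin zero = []
allFin (suc n) = zero ∷ map suc (allFin n)

countB : ∀ {A : Set} → (A → Bool) → List A → ℕ
countB p [] = 0
countB p (a ∷ as) = (if p a then 1 else 0) + countB p as

allB : ∀ {A : Set} → (A → Bool) → List A → Bool
allB p [] = true
allB p (a ∷ as) = p a ∧ allB p as

stableIn : ∀ {n} → Graph n → (Fin n → Bool) → Vec Bool n → Bool
stableIn {n} G S s =
  allB (λ u → not (lookup s u) ∨ S u) (allFin n) ∧
  allB (λ u → allB (λ v → not (lookup s u ∧ lookup s v ∧ G u v)) (allFin n)) (allFin n)

-- F(G[S]): number of stable sets (including ∅) of the subgraph of G induced by S.
FInd : ∀ {n} → Graph n → (Fin n → Bool) → ℕ
FInd {n} G S = countB (stableIn G S) (subsets n)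

F : ∀ {n} → Graph n → ℕ
F G = FInd G (λ _ → true)

minusV : ∀ {n} → (Fin n → Bool) → Fin n → (Fin n → Bool)
minusV S v u = S u ∧ not (u == v)

prodOver : ∀ {n} → (Fin n → Bool) → (Fin n → ℕ) → ℕ
prodOver {n} P f = foldr (λ v acc → (if P v then f v else 1) * acc) 1 (allFin n)

module Submission where

-- Deleting x and then x′ writes F(G) as F(G − x − x′) + F(G − x − N[x′]) + F(G − x′ − N[x]),
-- plus F(G − N[x] − N[x′]) when x ≁ x′. For T and ρ(T) the first and the last term agree, while each
-- middle term factors over the components T_y, T_z, T_{x_i}, T_{x′_j} of T − {x, x′}: a component
-- whose root is adjacent to the deleted vertex contributes F(T_v − v) (for T_z the root towards x′
-- is z′), any other one F(T_v). Moving y from x to x′ only swaps the roles of F(T_y) and F(T_y − y),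
-- and F(T_y) = F(T_y − y) + k with k ≥ 1, so F(T) − F(ρ(T)) = k (X X̄′ Z̄_{z′} − X̄ X′ Z̄_z).

open import Defs
open import Data.Nat using (ℕ; zero; suc; _+_; _*_; _<_; _>_; _≤_; z≤n; s≤s)
open import Data.Nat.Properties
  using ( +-assoc; +-comm; +-suc; +-identityʳ; *-distribʳ-+; ≤-trans; m≤m+n
        ; +-cancelˡ-<; +-monoʳ-<; *-cancelˡ-<; *-monoʳ-<)
open import Data.Nat.Tactic.RingSolver using (solve-∀)
open import Data.Bool using (Bool; true; false; _∧_; _∨_; not; if_then_else_)
open import Data.Bool.Properties
  using (∧-comm; ∨-comm; ∧-conicalˡ; ∧-conicalʳ; ∧-identityʳ; ∧-zeroʳ; ∨-identityʳ; ∨-zeroʳ; ¬-not; not-¬)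
open import Data.Fin using (Fin; zero; suc)
open import Data.Fin.Properties using (_≟_)
open import Data.Vec using (Vec; []; _∷_; lookup; replicate; _[_]≔_)
open import Data.Vec.Properties using (lookup∘update; lookup∘update′; lookup-replicate)
open import Data.List using (List; []; _∷_; _++_; map; foldr)
import Data.List.Base as List
open import Data.Bool.ListAction using (any)
open import Data.List.Properties using (map-tabulate)
open import Data.List.Membership.Propositional using (_∈_)
import Data.List.Membership.Propositional.Properties as Membership
open import Data.List.Relation.Unary.Any using (here; there)
open import Data.List.Relation.Unary.Unique.Propositional using (Unique; []; _∷_)
open import Data.List.Relation.Unary.Unique.Propositional.Properties using (allFin⁺)
import Data.List.Relation.Unary.All as All
import Data.List.Relation.Unary.AllPairs as AllPairs
open import Data.List.Relation.Unary.All.Properties using (¬Any⇒All¬)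
open import Relation.Binary.Construct.Closure.ReflexiveTransitive as Star using (Star; ε; _◅_; _◅◅_)
open import Data.Product using (Σ; _×_; _,_; proj₁; proj₂)
open import Data.Sum using (_⊎_; inj₁; inj₂; [_,_]′)
open import Data.Empty using (⊥; ⊥-elim)
open import Function using (_∘_; case_of_)
open import Function.Bundles using (_⇔_; Equivalence; mk⇔)
open import Relation.Nullary using (¬_; yes; no)
open import Relation.Nullary.Decidable using (dec-true; dec-false)
open import Relation.Binary.PropositionalEquality

private variable
  n : ℕ
  A : Set

∧-trueˡ : ∀ {a b} → a ∧ b ≡ true → a ≡ true
∧-trueˡ {a} {b} = ∧-conicalˡ a b

∧-trueʳ : ∀ {a b} → a ∧ b ≡ true → b ≡ true
∧-trueʳ {a} {b} = ∧-conicalʳ a b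

∧-true : ∀ {a b} → a ≡ true → b ≡ true → a ∧ b ≡ true
∧-true refl refl = refl

∨-true⁻ : ∀ {a b} → a ∨ b ≡ true → a ≡ true ⊎ b ≡ true
∨-true⁻ {true} _ = inj₁ refl
∨-true⁻ {false} e = inj₂ e

∨-trueˡ : ∀ {a b} → a ≡ true → a ∨ b ≡ true
∨-trueˡ refl = refl

∨-trueʳ : ∀ {a b} → b ≡ true → a ∨ b ≡ true
∨-trueʳ {a} refl = ∨-zeroʳ a

not-true⁻ : ∀ {a} → not a ≡ true → a ≡ false
not-true⁻ {false} _ = refl

not-true : ∀ {a} → a ≡ false → not a ≡ true
not-true refl = refl

Bool-ext : ∀ {a b} → (a ≡ true → b ≡ true) → (b ≡ true → a ≡ true) → a ≡ b
Bool-ext {true} f _ = sym (f refl)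
Bool-ext {false} {true} _ g = g refl
Bool-ext {false} {false} _ _ = refl

∨-∧-not : ∀ a b c → (b ≡ true → c ≡ false) → (a ∨ b) ∧ not c ≡ (a ∧ not c) ∨ b
∨-∧-not true  true  c h rewrite h refl = refl
∨-∧-not false true  c h rewrite h refl = refl
∨-∧-not true  false c _ = sym (∨-identityʳ (not c))
∨-∧-not false false c _ = refl

∧-swapʳ : ∀ a b c → (a ∧ b) ∧ c ≡ (a ∧ c) ∧ b
∧-swapʳ false b c = refl
∧-swapʳ true b c = ∧-comm b c

∧-not-∨ : ∀ a p c q → ((a ∧ not p) ∧ c) ∧ not q ≡ (a ∧ c) ∧ not (p ∨ q)
∧-not-∨ false p c q = refl
∧-not-∨ true true c q = sym (∧-zeroʳ c)
∧-not-∨ true false c q = refl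

==-refl : (u : Fin n) → (u == u) ≡ true
==-refl u = dec-true (u ≟ u) refl

==-false : ∀ (u v : Fin n) → u ≢ v → (u == v) ≡ false
==-false u v = dec-false (u ≟ v)

==-true⁻ : ∀ (u v : Fin n) → (u == v) ≡ true → u ≡ v
==-true⁻ u v e with u ≟ v
... | yes u≡v = u≡v

==-false⁻ : ∀ (u v : Fin n) → (u == v) ≡ false → u ≢ v
==-false⁻ u v e refl = not-¬ (==-refl u) e

not-==⁺ : ∀ (u v : Fin n) → u ≢ v → not (u == v) ≡ true
not-==⁺ u v = not-true ∘ ==-false u v

not-==⁻ : ∀ (u v : Fin n) → not (u == v) ≡ true → u ≢ v
not-==⁻ u v e refl = not-¬ (==-refl u) (not-true⁻ e)

==-∧-false : ∀ {u a v b : Fin n} → u ≢ a ⊎ v ≢ b → (u == a ∧ v == b) ≡ false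
==-∧-false {u = u} {a} (inj₁ u≢a) rewrite ==-false u a u≢a = refl
==-∧-false {u = u} {a} {v} {b} (inj₂ v≢b) rewrite ==-false v b v≢b = ∧-zeroʳ (u == a)

edge-test-sym : ∀ (a b u v : Fin n) →
  ((u == a ∧ v == b) ∨ (u == b ∧ v == a)) ≡ ((v == a ∧ u == b) ∨ (v == b ∧ u == a))
edge-test-sym a b u v =
  trans (∨-comm (u == a ∧ v == b) _) (cong₂ _∨_ (∧-comm (u == b) (v == a)) (∧-comm (u == a) (v == b)))

allFin≡tabulate : ∀ n → allFin n ≡ List.allFin n
allFin≡tabulate zero = refl
allFin≡tabulate (suc n) =
  cong (zero ∷_) (trans (cong (map suc) (allFin≡tabulate n)) (map-tabulate (λ i → i) suc))

∈-allFin : (u : Fin n) → u ∈ allFin n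
∈-allFin {n} u = subst (u ∈_) (sym (allFin≡tabulate n)) (Membership.∈-allFin u)

allFin-unique : ∀ n → Unique (allFin n)
allFin-unique n = subst Unique (sym (allFin≡tabulate n)) (allFin⁺ n)

allB-true⁻ : ∀ {p : A → Bool} {xs} → allB p xs ≡ true → ∀ {a} → a ∈ xs → p a ≡ true
allB-true⁻ e (here refl) = ∧-trueˡ e
allB-true⁻ {p = p} {x ∷ _} e (there a∈xs) = allB-true⁻ (∧-trueʳ {p x} e) a∈xs

allB-true⁺ : ∀ {p : A → Bool} xs → (∀ {a} → a ∈ xs → p a ≡ true) → allB p xs ≡ true
allB-true⁺ [] _ = refl
allB-true⁺ (x ∷ xs) h = ∧-true (h (here refl)) (allB-true⁺ xs (h ∘ there))

any-true⁻ : ∀ {p : A → Bool} xs → any p xs ≡ true → Σ A λ a → a ∈ xs × p a ≡ true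
any-true⁻ {p = p} (x ∷ xs) e with ∨-true⁻ {p x} e
... | inj₁ px = x , here refl , px
... | inj₂ rest with any-true⁻ xs rest
...   | a , a∈xs , pa = a , there a∈xs , pa

any-true⁺ : ∀ {p : A → Bool} {xs a} → a ∈ xs → p a ≡ true → any p xs ≡ true
any-true⁺ (here refl) pa = ∨-trueˡ pa
any-true⁺ {p = p} {x ∷ _} (there a∈xs) pa = ∨-trueʳ {p x} (any-true⁺ a∈xs pa)

lastOf-∈ : ∀ (w : Fin n) vs → lastOf w vs ∈ w ∷ vs
lastOf-∈ w [] = here refl
lastOf-∈ w (v ∷ vs) = there (lastOf-∈ v vs)

countB-++ : ∀ (p : A → Bool) xs ys → countB p (xs ++ ys) ≡ countB p xs + countB p ys
countB-++ p [] ys = refl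
countB-++ p (x ∷ xs) ys =
  trans (cong (_ +_) (countB-++ p xs ys)) (sym (+-assoc (if p x then 1 else 0) _ _))

countB-map : ∀ {B : Set} (p : B → Bool) (f : A → B) xs → countB p (map f xs) ≡ countB (p ∘ f) xs
countB-map p f [] = refl
countB-map p f (x ∷ xs) = cong (_ +_) (countB-map p f xs)

countB-cong : ∀ {p q : A → Bool} → p ≗ q → ∀ xs → countB p xs ≡ countB q xs
countB-cong e [] = refl
countB-cong e (x ∷ xs) = cong₂ (λ b m → (if b then 1 else 0) + m) (e x) (countB-cong e xs)

countB-false : ∀ (xs : List A) → countB (λ _ → false) xs ≡ 0
countB-false [] = refl
countB-false (x ∷ xs) = countB-false xs

countB-split : ∀ (p q : A → Bool) xs →
  countB p xs ≡ countB (λ a → p a ∧ q a) xs + countB (λ a → p a ∧ not (q a)) xs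
countB-split p q [] = refl
countB-split p q (x ∷ xs) with p x | q x
... | false | _ = countB-split p q xs
... | true | true = cong suc (countB-split p q xs)
... | true | false = trans (cong suc (countB-split p q xs)) (sym (+-suc _ _))

countSubsets : (Vec Bool n → Bool) → ℕ
countSubsets {n} p = countB p (subsets n)

countSubsets-suc : (p : Vec Bool (suc n) → Bool) →
  countSubsets p ≡ countSubsets (p ∘ (false ∷_)) + countSubsets (p ∘ (true ∷_))
countSubsets-suc {n} p = trans (countB-++ p (map (false ∷_) (subsets n)) (map (true ∷_) (subsets n)))
  (cong₂ _+_ (countB-map p (false ∷_) (subsets n)) (countB-map p (true ∷_) (subsets n)))

countSubsets-cong : ∀ {p q : Vec Bool n → Bool} → p ≗ q → countSubsets p ≡ countSubsets q
countSubsets-cong {n} e = countB-cong e (subsets n)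

countSubsets-positive : (p : Vec Bool n → Bool) → p (replicate n false) ≡ true → 1 ≤ countSubsets p
countSubsets-positive {zero} p e rewrite e = s≤s z≤n
countSubsets-positive {suc n} p e rewrite countSubsets-suc p =
  ≤-trans (countSubsets-positive (p ∘ (false ∷_)) e) (m≤m+n _ _)

countSubsets-only-empty : (p : Vec Bool n → Bool) → (∀ s → p s ≡ true → ∀ u → lookup s u ≡ false) →
  p (replicate n false) ≡ true → countSubsets p ≡ 1
countSubsets-only-empty {zero} p _ e rewrite e = refl
countSubsets-only-empty {suc n} p h e = trans (countSubsets-suc p) (cong₂ _+_
  (countSubsets-only-empty (p ∘ (false ∷_)) (λ s ps u → h (false ∷ s) ps (suc u)) e)
  (trans (countSubsets-cong (λ s → ¬-not λ ps → not-¬ refl (h (true ∷ s) ps zero))) (countB-false (subsets n))))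

countSubsets-insert : (p : Vec Bool n → Bool) (a : Fin n) →
  countSubsets (λ s → p s ∧ lookup s a) ≡ countSubsets (λ s → p (s [ a ]≔ true) ∧ not (lookup s a))
countSubsets-insert {suc n} p zero = begin
  countSubsets (λ s → p s ∧ lookup s zero)
    ≡⟨ countSubsets-suc {n} _ ⟩
  countSubsets (λ t → p (false ∷ t) ∧ false) + countSubsets (λ t → p (true ∷ t) ∧ true)
    ≡⟨ cong₂ _+_ (trans (countSubsets-cong (∧-zeroʳ ∘ p ∘ (false ∷_))) (countB-false (subsets n)))
                 (countSubsets-cong (∧-identityʳ ∘ p ∘ (true ∷_))) ⟩
  0 + countSubsets (p ∘ (true ∷_))
    ≡⟨ +-comm 0 _ ⟩
  countSubsets (p ∘ (true ∷_)) + 0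
    ≡⟨ sym (cong₂ _+_ (countSubsets-cong (∧-identityʳ ∘ p ∘ (true ∷_)))
                      (trans (countSubsets-cong (∧-zeroʳ ∘ p ∘ (true ∷_))) (countB-false (subsets n)))) ⟩
  countSubsets (λ t → p (true ∷ t) ∧ true) + countSubsets (λ t → p (true ∷ t) ∧ false)
    ≡⟨ sym (countSubsets-suc {n} _) ⟩
  countSubsets (λ s → p (s [ zero ]≔ true) ∧ not (lookup s zero)) ∎
  where open ≡-Reasoning
countSubsets-insert {suc n} p (suc a) = begin
  countSubsets (λ s → p s ∧ lookup s (suc a))
    ≡⟨ countSubsets-suc {n} _ ⟩
  countSubsets (λ t → p (false ∷ t) ∧ lookup t a) + countSubsets (λ t → p (true ∷ t) ∧ lookup t a)
    ≡⟨ cong₂ _+_ (countSubsets-insert (p ∘ (false ∷_)) a) (countSubsets-insert (p ∘ (true ∷_)) a) ⟩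
  countSubsets (λ t → p (false ∷ t [ a ]≔ true) ∧ not (lookup t a))
    + countSubsets (λ t → p (true ∷ t [ a ]≔ true) ∧ not (lookup t a))
    ≡⟨ sym (countSubsets-suc {n} _) ⟩
  countSubsets (λ s → p (s [ suc a ]≔ true) ∧ not (lookup s (suc a))) ∎
  where open ≡-Reasoning

-- Stable sets

Stable : Graph n → (Fin n → Bool) → Vec Bool n → Set
Stable G S s = (∀ u → lookup s u ≡ true → S u ≡ true)
             × (∀ u v → lookup s u ≡ true → lookup s v ≡ true → G u v ≡ false)

stableIn⇒Stable : ∀ (G : Graph n) S s → stableIn G S s ≡ true → Stable G S s
stableIn⇒Stable {n} G S s e = inside , independent
  where
  inside : ∀ u → lookup s u ≡ true → S u ≡ true
  inside u su = subst (λ b → not b ∨ S u ≡ true) su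
    (allB-true⁻ {p = λ u → not (lookup s u) ∨ S u} (∧-trueˡ e) (∈-allFin u))
  independent : ∀ u v → lookup s u ≡ true → lookup s v ≡ true → G u v ≡ false
  independent u v su sv = not-true⁻ (subst₂ (λ b c → not (b ∧ c ∧ G u v) ≡ true) su sv
    (allB-true⁻ {p = λ v → not (lookup s u ∧ lookup s v ∧ G u v)}
      (allB-true⁻ {p = λ u → allB (λ v → not (lookup s u ∧ lookup s v ∧ G u v)) (allFin n)}
        (∧-trueʳ {allB (λ u → not (lookup s u) ∨ S u) (allFin n)} e) (∈-allFin u)) (∈-allFin v)))

Stable⇒stableIn : ∀ (G : Graph n) S s → Stable G S s → stableIn G S s ≡ true
Stable⇒stableIn {n} G S s (inside , independent) =
  ∧-true (allB-true⁺ (allFin n) λ {u} _ → inside′ u)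
         (allB-true⁺ (allFin n) λ {u} _ → allB-true⁺ (allFin n) λ {v} _ → independent′ u v)
  where
  inside′ : ∀ u → (not (lookup s u) ∨ S u) ≡ true
  inside′ u with lookup s u in su
  ... | true = inside u su
  ... | false = refl
  independent′ : ∀ u v → not (lookup s u ∧ lookup s v ∧ G u v) ≡ true
  independent′ u v with lookup s u in su | lookup s v in sv
  ... | false | _ = refl
  ... | true | false = refl
  ... | true | true = not-true (independent u v su sv)

FInd-cong : ∀ {G H : Graph n} {S S′} → (∀ u v → S u ≡ true → S v ≡ true → G u v ≡ H u v) →
  S ≗ S′ → FInd G S ≡ FInd H S′
FInd-cong {G = G} {H} {S} {S′} G≡H S≗S′ = countSubsets-cong λ s → Bool-ext
  (λ e → let (inS , indep) = stableIn⇒Stable G S s e in Stable⇒stableIn H S′ s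
    ( (λ u su → trans (sym (S≗S′ u)) (inS u su))
    , (λ u v su sv → trans (sym (G≡H u v (inS u su) (inS v sv))) (indep u v su sv))))
  (λ e → let (inS′ , indep) = stableIn⇒Stable H S′ s e
             inS : ∀ u → lookup s u ≡ true → S u ≡ true
             inS u su = trans (S≗S′ u) (inS′ u su)
         in Stable⇒stableIn G S s
    (inS , (λ u v su sv → trans (G≡H u v (inS u su) (inS v sv)) (indep u v su sv))))

FInd-congʳ : ∀ {G : Graph n} {S S′} → S ≗ S′ → FInd G S ≡ FInd G S′
FInd-congʳ = FInd-cong (λ _ _ _ _ → refl)

stable-∅ : ∀ (G : Graph n) S → Stable G S (replicate n false)
stable-∅ {n} G S = (λ u e → ⊥-elim (∅-empty u e)) , (λ u _ e _ → ⊥-elim (∅-empty u e))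
  where
  ∅-empty : ∀ u → lookup (replicate n false) u ≢ true
  ∅-empty u e = not-¬ e (lookup-replicate u false)

FInd-positive : ∀ (G : Graph n) S → 1 ≤ FInd G S
FInd-positive G S = countSubsets-positive (stableIn G S) (Stable⇒stableIn G S (replicate _ false) (stable-∅ G S))

FInd-∅ : ∀ (G : Graph n) S → (∀ u → S u ≡ false) → FInd G S ≡ 1
FInd-∅ G S empty = countSubsets-only-empty (stableIn G S)
  (λ s e u → ¬-not λ su → not-¬ (proj₁ (stableIn⇒Stable G S s e) u su) (empty u))
  (Stable⇒stableIn G S (replicate _ false) (stable-∅ G S))

infixl 7 _∖_
_∖_ : (Fin n → Bool) → (Fin n → Bool) → Fin n → Bool
(S ∖ D) u = S u ∧ not (D u)

module _ (s : Vec Bool n) (a : Fin n) where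

  ∈-insert⁺ : ∀ {u} → lookup s u ≡ true → lookup (s [ a ]≔ true) u ≡ true
  ∈-insert⁺ {u} su with u ≟ a
  ... | yes refl = lookup∘update a s true
  ... | no u≢a = trans (lookup∘update′ u≢a s true) su

  ∈-insert⁻ : ∀ {u} → lookup (s [ a ]≔ true) u ≡ true → u ≡ a ⊎ lookup s u ≡ true
  ∈-insert⁻ {u} e with u ≟ a
  ... | yes u≡a = inj₁ u≡a
  ... | no u≢a = inj₂ (trans (sym (lookup∘update′ u≢a s true)) e)

module _ (G : Graph n) (S : Fin n → Bool) (a : Fin n) where

  stable-avoiding : ∀ s → (stableIn G S s ∧ not (lookup s a)) ≡ stableIn G (minusV S a) s
  stable-avoiding s = Bool-ext to from
    where
    to : (stableIn G S s ∧ not (lookup s a)) ≡ true → stableIn G (minusV S a) s ≡ true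
    to e with stableIn G S s in st | lookup s a in a∉s
    ... | true | false = let (inS , indep) = stableIn⇒Stable G S s st in Stable⇒stableIn G _ s
      ((λ u su → ∧-true (inS u su) (not-==⁺ u a λ { refl → not-¬ su a∉s })) , indep)
    from : stableIn G (minusV S a) s ≡ true → (stableIn G S s ∧ not (lookup s a)) ≡ true
    from e = let (inS-a , indep) = stableIn⇒Stable G _ s e in
      ∧-true (Stable⇒stableIn G S s ((λ u su → ∧-trueˡ (inS-a u su)) , indep))
             (not-true (¬-not λ sa → not-==⁻ a a (∧-trueʳ {S a} (inS-a a sa)) refl))

  stable-through : (∀ u v → G u v ≡ G v u) → G a a ≡ false → S a ≡ true →
    ∀ s → (stableIn G S (s [ a ]≔ true) ∧ not (lookup s a)) ≡ stableIn G (minusV S a ∖ G a) s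
  stable-through sym-G loop Sa s = Bool-ext to from
    where
    s′ = s [ a ]≔ true
    to : (stableIn G S s′ ∧ not (lookup s a)) ≡ true → stableIn G (minusV S a ∖ G a) s ≡ true
    to e with stableIn G S s′ in st | lookup s a in a∉s
    ... | true | false = let (inS , indep) = stableIn⇒Stable G S s′ st in Stable⇒stableIn G _ s
      ( (λ u su → ∧-true (∧-true (inS u (∈-insert⁺ s a su)) (not-==⁺ u a λ { refl → not-¬ su a∉s }))
                         (not-true (indep a u (lookup∘update a s true) (∈-insert⁺ s a su))))
      , (λ u v su sv → indep u v (∈-insert⁺ s a su) (∈-insert⁺ s a sv)))
    from : stableIn G (minusV S a ∖ G a) s ≡ true → (stableIn G S s′ ∧ not (lookup s a)) ≡ true
    from e = ∧-true (Stable⇒stableIn G S s′ (inS′ , indep′)) (not-true a∉s)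
      where
      inN = proj₁ (stableIn⇒Stable G _ s e)
      indep = proj₂ (stableIn⇒Stable G _ s e)
      a∉s : lookup s a ≡ false
      a∉s = ¬-not λ sa → not-==⁻ a a (∧-trueʳ {S a} (∧-trueˡ (inN a sa))) refl
      inS′ : ∀ u → lookup s′ u ≡ true → S u ≡ true
      inS′ u su′ with ∈-insert⁻ s a su′
      ... | inj₁ refl = Sa
      ... | inj₂ su = ∧-trueˡ (∧-trueˡ (inN u su))
      a≁ : ∀ {u} → lookup s u ≡ true → G a u ≡ false
      a≁ {u} su = not-true⁻ (∧-trueʳ {minusV S a u} (inN u su))
      indep′ : ∀ u v → lookup s′ u ≡ true → lookup s′ v ≡ true → G u v ≡ false
      indep′ u v su′ sv′ with ∈-insert⁻ s a su′ | ∈-insert⁻ s a sv′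
      ... | inj₁ refl | inj₁ refl = loop
      ... | inj₁ refl | inj₂ sv = a≁ sv
      ... | inj₂ su | inj₁ refl = trans (sym-G u a) (a≁ su)
      ... | inj₂ su | inj₂ sv = indep u v su sv

FInd-delete : ∀ (G : Graph n) S a → (∀ u v → G u v ≡ G v u) → G a a ≡ false → S a ≡ true →
  FInd G S ≡ FInd G (minusV S a) + FInd G (minusV S a ∖ G a)
FInd-delete {n} G S a sym-G loop Sa = begin
  FInd G S
    ≡⟨ countB-split (stableIn G S) (λ s → lookup s a) (subsets n) ⟩
  countSubsets (λ s → stableIn G S s ∧ lookup s a) + countSubsets (λ s → stableIn G S s ∧ not (lookup s a))
    ≡⟨ +-comm (countSubsets (λ s → stableIn G S s ∧ lookup s a)) _ ⟩
  countSubsets (λ s → stableIn G S s ∧ not (lookup s a)) + countSubsets (λ s → stableIn G S s ∧ lookup s a)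
    ≡⟨ cong₂ _+_ (countSubsets-cong (stable-avoiding G S a))
                 (trans (countSubsets-insert (stableIn G S) a)
                        (countSubsets-cong (stable-through G S a sym-G loop Sa))) ⟩
  FInd G (minusV S a) + FInd G (minusV S a ∖ G a) ∎
  where open ≡-Reasoning

_⊆_ : (Fin n → Bool) → (Fin n → Bool) → Set
A ⊆ B = ∀ u → A u ≡ true → B u ≡ true

infixl 6 _∪_
_∪_ : (Fin n → Bool) → (Fin n → Bool) → Fin n → Bool
(A ∪ B) u = A u ∨ B u

Separated : Graph n → (Fin n → Bool) → (Fin n → Bool) → Set
Separated G A B = (∀ u → A u ≡ true → B u ≡ true → ⊥)
                × (∀ u v → A u ≡ true → B v ≡ true → G u v ≡ false)

Separated-⊆ : ∀ {G : Graph n} {A A′ B B′} → A′ ⊆ A → B′ ⊆ B → Separated G A B → Separated G A′ B′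
Separated-⊆ A′⊆A B′⊆B (disjoint , no-edge) =
  (λ u a b → disjoint u (A′⊆A u a) (B′⊆B u b)) , (λ u v a b → no-edge u v (A′⊆A u a) (B′⊆B v b))

Separated-∪ˡ : ∀ {G : Graph n} {A B C} → Separated G A C → Separated G B C → Separated G (A ∪ B) C
Separated-∪ˡ {A = A} (disjointA , no-edgeA) (disjointB , no-edgeB) =
  (λ u AB C → [ (λ Au → disjointA u Au C) , (λ Bu → disjointB u Bu C) ]′ (∨-true⁻ {A u} AB)) ,
  (λ u v AB C → [ (λ Au → no-edgeA u v Au C) , (λ Bu → no-edgeB u v Bu C) ]′ (∨-true⁻ {A u} AB))

Separated-sym : ∀ {G : Graph n} {A B} → (∀ u v → G u v ≡ G v u) → Separated G A B → Separated G B A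
Separated-sym sym-G (disjoint , no-edge) =
  (λ u Bu Au → disjoint u Au Bu) , (λ u v Bu Av → trans (sym-G u v) (no-edge v u Av Bu))

⋃ : (Fin n → Bool) → (Fin n → Fin n → Bool) → Fin n → Bool
⋃ {n} P C u = any (λ r → P r ∧ C r u) (allFin n)

Separated-⋃ˡ : ∀ {G : Graph n} {P C B} → (∀ r → P r ≡ true → Separated G (C r) B) → Separated G (⋃ P C) B
Separated-⋃ˡ {n} {P = P} {C} sep =
  (λ u e Bu → let (r , _ , PC) = any-true⁻ (allFin n) e in proj₁ (sep r (∧-trueˡ PC)) u (∧-trueʳ {P r} PC) Bu) ,
  (λ u v e Bv → let (r , _ , PC) = any-true⁻ (allFin n) e in proj₂ (sep r (∧-trueˡ PC)) u v (∧-trueʳ {P r} PC) Bv)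

∖-disjoint : ∀ {C D : Fin n → Bool} → (∀ u → C u ≡ true → D u ≡ true → ⊥) → C ∖ D ≗ C
∖-disjoint {C = C} {D} C∩D=∅ u with C u in Cu | D u in Du
... | false | _ = refl
... | true | false = refl
... | true | true = ⊥-elim (C∩D=∅ u Cu Du)

∖-single : ∀ {C D : Fin n → Bool} {r} → (∀ u → C u ≡ true → D u ≡ true → u ≡ r) → (C r ≡ true → D r ≡ true) →
  C ∖ D ≗ minusV C r
∖-single {C = C} {D} {r} C∩D⊆r C∋r⇒D∋r u = Bool-ext
  (λ e → ∧-true (∧-trueˡ e) (not-==⁺ u r λ { refl → not-¬ (C∋r⇒D∋r (∧-trueˡ e)) (not-true⁻ (∧-trueʳ {C u} e)) }))
  (λ e → ∧-true (∧-trueˡ e) (not-true (¬-not λ Du → not-==⁻ u r (∧-trueʳ {C u} e) (C∩D⊆r u (∧-trueˡ e) Du))))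

module _ {A B : Fin n → Bool} {a : Fin n} (Ba : B a ≡ false) where

  private
    B-avoids-a : ∀ u → B u ≡ true → (u == a) ≡ false
    B-avoids-a u Bu = ==-false u a λ { refl → not-¬ Bu Ba }

  minusV-∪ : minusV (A ∪ B) a ≗ (minusV A a ∪ B)
  minusV-∪ u = ∨-∧-not (A u) (B u) (u == a) (B-avoids-a u)

  minusV-∖-∪ : ∀ (G : Graph n) → (∀ v → B v ≡ true → G a v ≡ false) →
    minusV (A ∪ B) a ∖ G a ≗ (minusV A a ∖ G a) ∪ B
  minusV-∖-∪ G a≁B u = trans (cong (_∧ not (G a u)) (minusV-∪ u))
    (∨-∧-not (minusV A a u) (B u) (G a u) (a≁B u))

FInd-∪-covered : ∀ {G : Graph n} {A B} → IsSimple G → ∀ L → (∀ u → A u ≡ true → u ∈ L) →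
  Separated G A B → FInd G (A ∪ B) ≡ FInd G A * FInd G B
FInd-∪-covered {G = G} {A} {B} _ [] covered _ = begin
  FInd G (A ∪ B) ≡⟨ FInd-congʳ (λ u → cong (_∨ B u) (A-empty u)) ⟩
  FInd G B       ≡⟨ sym (+-identityʳ _) ⟩
  1 * FInd G B   ≡⟨ cong (_* FInd G B) (sym (FInd-∅ G A A-empty)) ⟩
  FInd G A * FInd G B ∎
  where
  open ≡-Reasoning
  A-empty : ∀ u → A u ≡ false
  A-empty u = ¬-not λ Au → case covered u Au of λ ()
FInd-∪-covered {G = G} {A} {B} simple@(sym-G , loopless) (a ∷ L) covered sep@(disjoint , no-edge)
  with A a in Aa
... | false = FInd-∪-covered simple L covered′ sep
  where
  covered′ : ∀ u → A u ≡ true → u ∈ L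
  covered′ u Au with covered u Au
  ... | here refl = ⊥-elim (not-¬ Au Aa)
  ... | there u∈L = u∈L
... | true = begin
  FInd G (A ∪ B)
    ≡⟨ FInd-delete G (A ∪ B) a sym-G (loopless a) (∨-trueˡ Aa) ⟩
  FInd G (minusV (A ∪ B) a) + FInd G (minusV (A ∪ B) a ∖ G a)
    ≡⟨ cong₂ _+_ (FInd-congʳ (minusV-∪ {A = A} Ba))
                 (FInd-congʳ (minusV-∖-∪ {A = A} Ba G (λ v → no-edge a v Aa))) ⟩
  FInd G (minusV A a ∪ B) + FInd G ((minusV A a ∖ G a) ∪ B)
    ≡⟨ cong₂ _+_ (FInd-∪-covered simple L (λ u e → covered′ u e (covered u (∧-trueˡ e)))
                   (Separated-⊆ (λ _ → ∧-trueˡ) (λ _ Bu → Bu) sep))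
                 (FInd-∪-covered simple L (λ u e → covered′ u (∧-trueˡ e) (covered u (∧-trueˡ (∧-trueˡ e))))
                   (Separated-⊆ (λ _ → ∧-trueˡ ∘ ∧-trueˡ) (λ _ Bu → Bu) sep)) ⟩
  FInd G (minusV A a) * FInd G B + FInd G (minusV A a ∖ G a) * FInd G B
    ≡⟨ sym (*-distribʳ-+ (FInd G B) (FInd G (minusV A a)) _) ⟩
  (FInd G (minusV A a) + FInd G (minusV A a ∖ G a)) * FInd G B
    ≡⟨ cong (_* FInd G B) (sym (FInd-delete G A a sym-G (loopless a) Aa)) ⟩
  FInd G A * FInd G B ∎
  where
  open ≡-Reasoning
  Ba : B a ≡ false
  Ba = ¬-not (disjoint a Aa)
  covered′ : ∀ u → minusV A a u ≡ true → u ∈ a ∷ L → u ∈ L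
  covered′ u e (here refl) = ⊥-elim (not-==⁻ a a (∧-trueʳ {A a} e) refl)
  covered′ u e (there u∈L) = u∈L

FInd-∪ : ∀ {G : Graph n} {A B} → IsSimple G → Separated G A B → FInd G (A ∪ B) ≡ FInd G A * FInd G B
FInd-∪ {n} simple = FInd-∪-covered simple (allFin n) (λ u _ → ∈-allFin u)

module _ {G : Graph n} (simple : IsSimple G) (P : Fin n → Bool) (C : Fin n → Fin n → Bool)
  (separated : ∀ r r′ → r ≢ r′ → P r ≡ true → P r′ ≡ true → Separated G (C r) (C r′)) where

  FInd-⋃-list : ∀ L → Unique L →
    FInd G (λ u → any (λ r → P r ∧ C r u) L) ≡ foldr (λ r acc → (if P r then FInd G (C r) else 1) * acc) 1 L
  FInd-⋃-list [] _ = FInd-∅ G _ (λ _ → refl)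
  FInd-⋃-list (v ∷ L) (v∉L ∷ unique) with P v in Pv
  ... | false = trans (FInd-⋃-list L unique) (sym (+-identityʳ _))
  ... | true = trans (FInd-∪ simple (disjoint , no-edge)) (cong (FInd G (C v) *_) (FInd-⋃-list L unique))
    where
    rest = λ u → any (λ r → P r ∧ C r u) L
    separated-from : ∀ {u} → rest u ≡ true → Σ (Fin n) λ w → Separated G (C v) (C w) × C w u ≡ true
    separated-from {u} e with any-true⁻ L e
    ... | w , w∈L , Pw∧Cw = w , separated v w (All.lookup v∉L w∈L) Pv (∧-trueˡ Pw∧Cw) , ∧-trueʳ {P w} Pw∧Cw
    disjoint : ∀ u → C v u ≡ true → rest u ≡ true → ⊥
    disjoint u Cv e with separated-from e
    ... | w , sep , Cw = proj₁ sep u Cv Cw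
    no-edge : ∀ u u′ → C v u ≡ true → rest u′ ≡ true → G u u′ ≡ false
    no-edge u u′ Cv e with separated-from e
    ... | w , sep , Cw = proj₂ sep u u′ Cv Cw

  FInd-⋃ : FInd G (⋃ P C) ≡ prodOver P (λ r → FInd G (C r))
  FInd-⋃ = FInd-⋃-list (allFin n) (allFin-unique n)

prodOver-cong : ∀ (P : Fin n → Bool) {f g : Fin n → ℕ} → (∀ v → P v ≡ true → f v ≡ g v) →
  prodOver P f ≡ prodOver P g
prodOver-cong {n} P {f} {g} f≡g = go (allFin n)
  where
  go : ∀ L → foldr (λ v acc → (if P v then f v else 1) * acc) 1 L
           ≡ foldr (λ v acc → (if P v then g v else 1) * acc) 1 L
  go [] = refl
  go (v ∷ L) with P v in Pv
  ... | true = cong₂ _*_ (f≡g v Pv) (go L)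
  ... | false = cong (1 *_) (go L)

others : Fin n → Fin n → Fin n → Bool
others x x′ u = not (u == x) ∧ not (u == x′)

FInd-expand-pair : ∀ (G : Graph n) {x x′} → IsSimple G → x′ ≢ x →
  F G ≡ FInd G (others x x′) + FInd G (others x x′ ∖ G x′) + FInd G (others x x′ ∖ G x)
      + (if G x x′ then 0 else FInd G (others x x′ ∖ (G x ∪ G x′)))
FInd-expand-pair G {x} {x′} (sym-G , loopless) x′≢x = begin
  F G
    ≡⟨ FInd-delete G all x sym-G (loopless x) refl ⟩
  FInd G (minusV all x) + FInd G (minusV all x ∖ G x)
    ≡⟨ cong₂ _+_ (FInd-delete G (minusV all x) x′ sym-G (loopless x′) (not-==⁺ x′ x x′≢x)) N[x]-term ⟩
  (FInd G V₀ + FInd G (V₀ ∖ G x′)) + (FInd G (V₀ ∖ G x) + last-term)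
    ≡⟨ sym (+-assoc (FInd G V₀ + FInd G (V₀ ∖ G x′)) _ _) ⟩
  FInd G V₀ + FInd G (V₀ ∖ G x′) + FInd G (V₀ ∖ G x) + last-term ∎
  where
  open ≡-Reasoning
  all : Fin _ → Bool
  all _ = true
  V₀ = others x x′
  last-term = if G x x′ then 0 else FInd G (V₀ ∖ (G x ∪ G x′))
  N[x]-term : FInd G (minusV all x ∖ G x) ≡ FInd G (V₀ ∖ G x) + last-term
  N[x]-term with G x x′ in x~x′
  ... | false = trans
    (FInd-delete G (minusV all x ∖ G x) x′ sym-G (loopless x′) (∧-true (not-==⁺ x′ x x′≢x) (not-true x~x′)))
    (cong₂ _+_ (FInd-congʳ λ u → ∧-swapʳ (not (u == x)) (not (G x u)) (not (u == x′)))
               (FInd-congʳ λ u → ∧-not-∨ (not (u == x)) (G x u) (not (u == x′)) (G x′ u)))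
  ... | true = trans (FInd-congʳ x′∈N[x]) (sym (+-identityʳ _))
    where
    x′∈N[x] : minusV all x ∖ G x ≗ V₀ ∖ G x
    x′∈N[x] u with u ≟ x′
    ... | yes refl rewrite x~x′ = trans (∧-zeroʳ _) (sym (∧-zeroʳ _))
    ... | no _ = cong (_∧ not (G x u)) (sym (∧-identityʳ _))

-- Edge operations

deleteEdge-⊆ : ∀ (G : Graph n) a b {u v} → deleteEdge G a b u v ≡ true → G u v ≡ true
deleteEdge-⊆ G a b {u} {v} e with (u == a ∧ v == b) ∨ (u == b ∧ v == a)
... | false = e

deleteEdge-removes : ∀ (G : Graph n) a b → deleteEdge G a b a b ≡ false
deleteEdge-removes G a b rewrite ==-refl a | ==-refl b = refl

deleteEdge-keeps : ∀ (G : Graph n) a b {u v} → G u v ≡ true → u ≢ a ⊎ v ≢ b → u ≢ b ⊎ v ≢ a →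
  deleteEdge G a b u v ≡ true
deleteEdge-keeps G a b e ab ba rewrite ==-∧-false ab | ==-∧-false ba = e

module _ (G : Graph n) (a b : Fin n) where

  deleteEdge-symmetric : (∀ u v → G u v ≡ G v u) → ∀ u v → deleteEdge G a b u v ≡ deleteEdge G a b v u
  deleteEdge-symmetric sym-G u v = cong₂ (λ c e → if c then false else e) (edge-test-sym a b u v) (sym-G u v)

  addEdge-symmetric : (∀ u v → G u v ≡ G v u) → ∀ u v → addEdge G a b u v ≡ addEdge G a b v u
  addEdge-symmetric sym-G u v = cong₂ (λ c e → if c then true else e) (edge-test-sym a b u v) (sym-G u v)

  deleteEdge-loopless : ∀ v → G v v ≡ false → deleteEdge G a b v v ≡ false
  deleteEdge-loopless v loop with (v == a ∧ v == b) ∨ (v == b ∧ v == a)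
  ... | true = refl
  ... | false = loop

  addEdge-loopless : a ≢ b → ∀ v → G v v ≡ false → addEdge G a b v v ≡ false
  addEdge-loopless a≢b v loop with v == a in v≡a | v == b in v≡b
  ... | true  | true  = ⊥-elim (a≢b (trans (sym (==-true⁻ v a v≡a)) (==-true⁻ v b v≡b)))
  ... | true  | false = loop
  ... | false | true  = loop
  ... | false | false = loop

rho-simple : ∀ {T : Graph n} {x y x′} → IsSimple T → y ≢ x′ → IsSimple (rho T x y x′)
rho-simple {T = T} {x} {y} {x′} (sym-T , loopless) y≢x′ =
  addEdge-symmetric (deleteEdge T y x) y x′ (deleteEdge-symmetric T y x sym-T) ,
  λ v → addEdge-loopless (deleteEdge T y x) y x′ y≢x′ v (deleteEdge-loopless T y x v (loopless v))

-- Walks, paths and trees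

Walk : Graph n → Fin n → Fin n → Set
Walk G = Star (λ a b → G a b ≡ true)

Reach⇒Walk : ∀ {G : Graph n} {u v} → Reach G u v → Walk G u v
Reach⇒Walk (rest , walk , refl) = go rest walk
  where
  go : ∀ {G : Graph n} {u} rest → IsWalk G (u ∷ rest) → Walk G u (lastOf u rest)
  go [] _ = ε
  go (w ∷ rest) (step e walk) = e ◅ go rest walk

Walk⇒Reach : ∀ {G : Graph n} {u v} → Walk G u v → Reach G u v
Walk⇒Reach {u = u} ε = [] , single u , refl
Walk⇒Reach (_◅_ {j = w} e walk) with Walk⇒Reach walk
... | rest , walk′ , last = w ∷ rest , step e walk′ , last

Walk-reverse : ∀ {G : Graph n} → (∀ u v → G u v ≡ G v u) → ∀ {u v} → Walk G u v → Walk G v u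
Walk-reverse sym-G = Star.reverse λ {u} {v} e → trans (sym-G v u) e

IsWalk-map : ∀ {G H : Graph n} → (∀ {u v} → G u v ≡ true → H u v ≡ true) → ∀ {vs} → IsWalk G vs → IsWalk H vs
IsWalk-map f (single v) = single v
IsWalk-map f (step e walk) = step (f e) (IsWalk-map f walk)

IsWalk⇒Walk : ∀ {G H : Graph n} (Q : Fin n → Set) → (∀ {a b} → Q a → Q b → G a b ≡ true → H a b ≡ true) →
  ∀ {u} rest → IsWalk G (u ∷ rest) → All.All Q (u ∷ rest) → Walk H u (lastOf u rest)
IsWalk⇒Walk Q G⊆H [] _ _ = ε
IsWalk⇒Walk Q G⊆H (w ∷ rest) (step e walk) (Qu All.∷ Qs@(Qw All.∷ _)) =
  G⊆H Qu Qw e ◅ IsWalk⇒Walk Q G⊆H rest walk Qs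

module _ (G : Graph n) (p q : Fin n) where

  deleteVertices-edge⁻ : ∀ {a b} → deleteVertices G p q a b ≡ true →
    G a b ≡ true × (a ≢ p × a ≢ q) × (b ≢ p × b ≢ q)
  deleteVertices-edge⁻ {a} {b} e with a == p in ap | a == q in aq | b == p in bp | b == q in bq
  ... | false | false | false | false =
    e , (==-false⁻ a p ap , ==-false⁻ a q aq) , (==-false⁻ b p bp , ==-false⁻ b q bq)

  deleteVertices-edge⁺ : ∀ {a b} → G a b ≡ true → a ≢ p × a ≢ q → b ≢ p × b ≢ q →
    deleteVertices G p q a b ≡ true
  deleteVertices-edge⁺ {a} {b} e (a≢p , a≢q) (b≢p , b≢q)
    rewrite ==-false a p a≢p | ==-false a q a≢q | ==-false b p b≢p | ==-false b q b≢q = e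

  deleteVertices-⊆-deleteEdge : ∀ {c d a b} → c ≡ p ⊎ c ≡ q → deleteVertices G p q a b ≡ true →
    deleteEdge G c d a b ≡ true
  deleteVertices-⊆-deleteEdge {c} {d} c∈ e with deleteVertices-edge⁻ e
  ... | ab , (a≢p , a≢q) , (b≢p , b≢q) =
    deleteEdge-keeps G c d ab (inj₁ (avoid c∈ a≢p a≢q)) (inj₂ (avoid c∈ b≢p b≢q))
    where
    avoid : ∀ {c v} → c ≡ p ⊎ c ≡ q → v ≢ p → v ≢ q → v ≢ c
    avoid (inj₁ refl) v≢p _ = v≢p
    avoid (inj₂ refl) _ v≢q = v≢q

  Walk-deleteVertices-avoids : ∀ {u v} → Walk (deleteVertices G p q) u v → u ≢ p × u ≢ q → v ≢ p × v ≢ q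
  Walk-deleteVertices-avoids ε u∉ = u∉
  Walk-deleteVertices-avoids (e ◅ walk) _ =
    Walk-deleteVertices-avoids walk (proj₂ (proj₂ (deleteVertices-edge⁻ e)))

  walk-to-penultimate : ∀ u m {a b} → IsWalk G (u ∷ m ++ a ∷ b ∷ []) → All.All (_≢ p) (u ∷ m ++ a ∷ b ∷ []) →
    Unique (u ∷ m ++ a ∷ b ∷ []) → b ≡ q → Walk (deleteVertices G p q) u a × G a b ≡ true
  walk-to-penultimate u [] (step ua (step ab _)) (u≢p All.∷ a≢p All.∷ _)
    ((u≢a All.∷ u≢b All.∷ All.[]) ∷ (a≢b All.∷ All.[]) ∷ _) refl =
    deleteVertices-edge⁺ ua (u≢p , u≢b) (a≢p , a≢b) ◅ ε , ab
  walk-to-penultimate u (w ∷ m) (step uw walk) (u≢p All.∷ avoid@(w≢p All.∷ _)) (u≢ ∷ unique@(w≢ ∷ _)) refl =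
    deleteVertices-edge⁺ uw (u≢p , All.lookup u≢ (there (∈-end m))) (w≢p , All.lookup w≢ (∈-end m))
      ◅ proj₁ rest , proj₂ rest
    where
    rest = walk-to-penultimate w m walk avoid unique refl
    ∈-end : ∀ {a b} (m : List (Fin n)) → b ∈ m ++ a ∷ b ∷ []
    ∈-end [] = there (here refl)
    ∈-end (_ ∷ m) = there (∈-end m)

IsWalk-first-edge : ∀ {G : Graph n} {a b vs} → IsWalk G (a ∷ b ∷ vs) → G a b ≡ true
IsWalk-first-edge (step ab _) = ab

module _ {G : Graph n} where

  open import Data.List.Membership.DecPropositional (_≟_ {n}) using (_∈?_)

  PathFrom : Fin n → Fin n → Set
  PathFrom u v = Σ (List (Fin n)) λ rest → IsWalk G (u ∷ rest) × lastOf u rest ≡ v × Unique (u ∷ rest)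

  path-suffix : ∀ {u v} w rest → u ∈ w ∷ rest → IsWalk G (w ∷ rest) → lastOf w rest ≡ v →
    Unique (w ∷ rest) → PathFrom u v
  path-suffix w rest (here refl) walk last unique = rest , walk , last , unique
  path-suffix w (w′ ∷ rest) (there u∈) (step _ walk) last (_ ∷ unique) = path-suffix w′ rest u∈ walk last unique

  walk⇒path : ∀ {u} rest → IsWalk G (u ∷ rest) → PathFrom u (lastOf u rest)
  walk⇒path {u} [] _ = [] , single u , refl , All.[] ∷ []
  walk⇒path {u} (w ∷ rest) (step e walk) with walk⇒path rest walk
  ... | q , walk′ , last , unique with u ∈? (w ∷ q)
  ...   | yes u∈ = path-suffix w q u∈ walk′ last unique
  ...   | no u∉ = w ∷ q , step e walk′ , last , ¬Any⇒All¬ (w ∷ q) u∉ ∷ unique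

module _ {T : Graph n} (tree : IsTree T) where

  tree-edge-bridge : ∀ {a b} → T a b ≡ true → ¬ Walk (deleteEdge T a b) a b
  tree-edge-bridge {a} {b} ab walk with Walk⇒Reach walk
  ... | rest , walk′ , last with walk⇒path rest walk′
  ...   | [] , _ , last′ , _ =
    not-¬ (subst (λ c → T a c ≡ true) (sym (trans last′ last)) ab) (proj₂ (proj₁ tree) a)
  ...   | w ∷ [] , step e _ , last′ , _ =
    not-¬ (subst (λ c → deleteEdge T a b a c ≡ true) (trans last′ last) e) (deleteEdge-removes T a b)
  ...   | w ∷ w′ ∷ q , path , last′ , unique = proj₂ (proj₂ tree) (a ∷ w ∷ w′ ∷ q)
    ( IsWalk-map (deleteEdge-⊆ T a b) path , unique
    , trans (proj₁ (proj₁ tree) _ a) (trans (cong (T a) (trans last′ last)) ab))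

path-tail-avoids-start : ∀ {G : Graph n} {x z x′} mid → IsWalk G (x ∷ z ∷ mid) → Unique (x ∷ z ∷ mid) →
  lastOf z mid ≡ x′ → Walk (deleteVertices G x x) z x′
path-tail-avoids-start {G = G} {x} {z} mid (step _ walk) (x≢ ∷ _) last = subst (Walk _ z) last
  (IsWalk⇒Walk (_≢ x) (λ a≢x b≢x e → deleteVertices-edge⁺ G x x e (a≢x , a≢x) (b≢x , b≢x)) mid walk
    (All.map ≢-sym x≢))

path-of-length-one : ∀ {x z z′ x′ : Fin n} mid mid′ → x ∷ z ∷ mid ≡ mid′ ++ z′ ∷ x′ ∷ [] → lastOf z mid ≡ x′ →
  Unique (z ∷ mid) → z ≡ x′ → z′ ≡ x
path-of-length-one [] [] refl _ _ _ = refl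
path-of-length-one [] (_ ∷ []) () _ _ refl
path-of-length-one [] (_ ∷ _ ∷ []) () _ _ refl
path-of-length-one [] (_ ∷ _ ∷ _ ∷ _) () _ _ refl
path-of-length-one (w ∷ mid) _ _ last (z≢ ∷ _) refl = ⊥-elim (All.lookup z≢ (lastOf-∈ w mid) (sym last))

path-penultimate : ∀ {G : Graph n} {x z z′ x′} mid mid′ → x ∷ z ∷ mid ≡ mid′ ++ z′ ∷ x′ ∷ [] →
  IsWalk G (x ∷ z ∷ mid) → Unique (x ∷ z ∷ mid) → z ≢ x′ → Walk (deleteVertices G x x′) z z′ × G z′ x′ ≡ true
path-penultimate mid [] refl _ _ z≢x′ = ⊥-elim (z≢x′ refl)
path-penultimate mid (_ ∷ []) refl (step _ (step z′x′ _)) _ _ = ε , z′x′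
path-penultimate {x = x} {z} {x′ = x′} mid (_ ∷ _ ∷ m) refl (step _ walk) (x≢ ∷ unique) _ =
  walk-to-penultimate _ x x′ z m walk (All.map ≢-sym x≢) unique refl

module Components {T : Graph n} (tree : IsTree T) {x x′ : Fin n} (comp : Fin n → Fin n → Bool)
  (comp⇔ : ∀ v u → v ≢ x → v ≢ x′ → (comp v u ≡ true ⇔ Reach (deleteVertices T x x′) v u))
  (comp-outside : ∀ v u → (v ≡ x ⊎ v ≡ x′) → comp v u ≡ false) where

  T₀ : Graph n
  T₀ = deleteVertices T x x′

  Inner : Fin n → Set
  Inner u = u ≢ x × u ≢ x′

  T-symmetric : ∀ u v → T u v ≡ T v u
  T-symmetric = proj₁ (proj₁ tree)

  T₀-symmetric : ∀ u v → T₀ u v ≡ T₀ v u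
  T₀-symmetric u v = Bool-ext (flip u v) (flip v u)
    where
    flip : ∀ u v → T₀ u v ≡ true → T₀ v u ≡ true
    flip u v e with deleteVertices-edge⁻ T x x′ e
    ... | uv , u∉ , v∉ = deleteVertices-edge⁺ T x x′ (trans (T-symmetric v u) uv) v∉ u∉

  adjacent⇒≢ : ∀ {a b} → T a b ≡ true → a ≢ b
  adjacent⇒≢ {a} ab refl = not-¬ ab (proj₂ (proj₁ tree) a)

  comp⇒Inner : ∀ {v u} → comp v u ≡ true → Inner v
  comp⇒Inner {v} {u} c = (λ v≡x → not-¬ c (comp-outside v u (inj₁ v≡x)))
                       , (λ v≡x′ → not-¬ c (comp-outside v u (inj₂ v≡x′)))

  comp⇒Walk : ∀ {v u} → comp v u ≡ true → Walk T₀ v u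
  comp⇒Walk {v} {u} c = Reach⇒Walk (Equivalence.to (comp⇔ v u (proj₁ (comp⇒Inner c)) (proj₂ (comp⇒Inner c))) c)

  Walk⇒comp : ∀ {v u} → Inner v → Walk T₀ v u → comp v u ≡ true
  Walk⇒comp {v} {u} (v≢x , v≢x′) walk = Equivalence.from (comp⇔ v u v≢x v≢x′) (Walk⇒Reach walk)

  comp⇒Innerʳ : ∀ {v u} → comp v u ≡ true → Inner u
  comp⇒Innerʳ c = Walk-deleteVertices-avoids T x x′ (comp⇒Walk c) (comp⇒Inner c)

  comp-refl : ∀ {v} → Inner v → comp v v ≡ true
  comp-refl v∉ = Walk⇒comp v∉ ε

  comp-sym : ∀ {v u} → comp v u ≡ true → comp u v ≡ true
  comp-sym c = Walk⇒comp (comp⇒Innerʳ c) (Walk-reverse T₀-symmetric (comp⇒Walk c))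

  comp-trans : ∀ {a b u} → comp a b ≡ true → comp b u ≡ true → comp a u ≡ true
  comp-trans c c′ = Walk⇒comp (comp⇒Inner c) (comp⇒Walk c ◅◅ comp⇒Walk c′)

  comp-step : ∀ {a u v} → comp a u ≡ true → T u v ≡ true → Inner v → comp a v ≡ true
  comp-step c uv v∉ =
    Walk⇒comp (comp⇒Inner c) (comp⇒Walk c ◅◅ (deleteVertices-edge⁺ T x x′ uv (comp⇒Innerʳ c) v∉ ◅ ε))

  distinct-components-separated : ∀ {a b} → (comp a b ≡ true → ⊥) → Separated T (comp a) (comp b)
  distinct-components-separated ¬ab =
    (λ u au bu → ¬ab (comp-trans au (comp-sym bu))) ,
    (λ u v au bv → ¬-not λ uv → ¬ab (comp-trans (comp-step au uv (comp⇒Innerʳ bv)) (comp-sym bv)))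

  -- Two neighbours of x (or of x′) in one component would close a cycle through it.
  neighbour-unique : ∀ {c a b} → c ≡ x ⊎ c ≡ x′ → T c a ≡ true → T c b ≡ true → comp a b ≡ true → a ≡ b
  neighbour-unique {c} {a} {b} c∈ ca cb ab with a ≟ b
  ... | yes a≡b = a≡b
  ... | no a≢b = ⊥-elim (tree-edge-bridge tree cb
    (deleteEdge-keeps T c b ca (inj₂ a≢b) (inj₁ (adjacent⇒≢ cb))
      ◅ Star.map (deleteVertices-⊆-deleteEdge T x x′ c∈) (comp⇒Walk ab)))

  last-exit : ∀ {a u} → Walk T a u → Inner u →
    (Inner a × Walk T₀ a u) ⊎ (Σ (Fin n) λ c → Σ (Fin n) λ w → (c ≡ x ⊎ c ≡ x′) × T c w ≡ true × comp w u ≡ true)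
  last-exit ε u∉ = inj₁ (u∉ , ε)
  last-exit (_◅_ {i = a} {j = w} aw walk) u∉ with last-exit walk u∉
  ... | inj₂ exit = inj₂ exit
  ... | inj₁ (w∉ , walk₀) with a ≟ x | a ≟ x′
  ...   | yes a≡x | _ = inj₂ (a , w , inj₁ a≡x , aw , Walk⇒comp w∉ walk₀)
  ...   | no _ | yes a≡x′ = inj₂ (a , w , inj₂ a≡x′ , aw , Walk⇒comp w∉ walk₀)
  ...   | no a≢x | no a≢x′ = inj₁ ((a≢x , a≢x′) , deleteVertices-edge⁺ T x x′ aw (a≢x , a≢x′) w∉ ◅ walk₀)

exchange-< : ∀ A E a b c d Ȳ k → 1 ≤ k →
  (A + a * Ȳ * b + c * (Ȳ + k) * d + E < A + a * (Ȳ + k) * b + c * Ȳ * d + E) ⇔ (c * d < a * b)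
exchange-< A E a b c d Ȳ k@(suc _) _ =
  subst₂ (λ l r → (l < r) ⇔ (c * d < a * b)) (sym (cd-side A E a b c d Ȳ k)) (sym (ab-side A E a b c d Ȳ k))
    (mk⇔ (*-cancelˡ-< k _ _ ∘ +-cancelˡ-< K _ _) (+-monoʳ-< K ∘ *-monoʳ-< k))
  where
  K = A + a * Ȳ * b + c * Ȳ * d + E
  ab-side : ∀ A E a b c d Ȳ k → A + a * (Ȳ + k) * b + c * Ȳ * d + E ≡ (A + a * Ȳ * b + c * Ȳ * d + E) + k * (a * b)
  ab-side = solve-∀
  cd-side : ∀ A E a b c d Ȳ k → A + a * Ȳ * b + c * (Ȳ + k) * d + E ≡ (A + a * Ȳ * b + c * Ȳ * d + E) + k * (c * d)
  cd-side = solve-∀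

module Rotation {T : Graph n} (tree : IsTree T) {x y x′ z z′ : Fin n} (comp : Fin n → Fin n → Bool)
  (x~y : T x y ≡ true) (x′≢x : x′ ≢ x) (x⇝x′ : Reach (deleteEdge T x y) x x′)
  {mid mid′ : List (Fin n)} (walk : IsWalk T (x ∷ z ∷ mid)) (unique : Unique (x ∷ z ∷ mid))
  (last : lastOf z mid ≡ x′) (ends : x ∷ z ∷ mid ≡ mid′ ++ z′ ∷ x′ ∷ [])
  (comp⇔ : ∀ v u → v ≢ x → v ≢ x′ → (comp v u ≡ true ⇔ Reach (deleteVertices T x x′) v u))
  (comp-outside : ∀ v u → (v ≡ x ⊎ v ≡ x′) → comp v u ≡ false) where

  open Components tree comp comp⇔ comp-outside

  simple : IsSimple T
  simple = proj₁ tree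

  x~z : T x z ≡ true
  x~z = IsWalk-first-edge walk

  z⇝x′ : Walk (deleteVertices T x x) z x′
  z⇝x′ = path-tail-avoids-start mid walk unique last

  z′-in-T_z : Inner z → comp z z′ ≡ true × T x′ z′ ≡ true
  z′-in-T_z (_ , z≢x′) with path-penultimate mid mid′ ends walk unique z≢x′
  ... | walk₀ , z′x′ = Walk⇒comp (≢-sym (adjacent⇒≢ x~z) , z≢x′) walk₀ , trans (T-symmetric x′ z′) z′x′

  y≢x′ : y ≢ x′
  y≢x′ refl = tree-edge-bridge tree x~y (Reach⇒Walk x⇝x′)

  y≢z : y ≢ z
  y≢z refl = tree-edge-bridge tree x~y
    (Reach⇒Walk x⇝x′ ◅◅ Walk-reverse (deleteEdge-symmetric T x y T-symmetric)
      (Star.map (deleteVertices-⊆-deleteEdge T x x (inj₁ refl)) z⇝x′))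

  y-Inner : Inner y
  y-Inner = ≢-sym (adjacent⇒≢ x~y) , y≢x′

  x-neighbour-unique : ∀ {a b} → T x a ≡ true → T x b ≡ true → comp a b ≡ true → a ≡ b
  x-neighbour-unique = neighbour-unique (inj₁ refl)

  x′-neighbour-unique : ∀ {a b} → T x′ a ≡ true → T x′ b ≡ true → comp a b ≡ true → a ≡ b
  x′-neighbour-unique = neighbour-unique (inj₂ refl)

  -- x – z ⇝ x′ – b ⇝ a would avoid the edge xa.
  x-neighbour-apart-x′-neighbour : ∀ {a b} → T x a ≡ true → a ≢ z → T x′ b ≡ true → comp b a ≡ true → ⊥
  x-neighbour-apart-x′-neighbour {a} {b} xa a≢z x′b ba = tree-edge-bridge tree xa
    (deleteEdge-keeps T x a x~z (inj₂ (λ z≡a → a≢z (sym z≡a))) (inj₁ (adjacent⇒≢ xa))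
      ◅ Star.map (deleteVertices-⊆-deleteEdge T x x (inj₁ refl)) z⇝x′
      ◅◅ deleteEdge-keeps T x a x′b (inj₁ x′≢x) (inj₂ (proj₁ (comp⇒Inner ba)))
      ◅ Star.map (deleteVertices-⊆-deleteEdge T x x′ (inj₁ refl)) (comp⇒Walk ba))

  z-Inner : z′ ≢ x → Inner z
  z-Inner z′≢x =
    ≢-sym (adjacent⇒≢ x~z) , λ z≡x′ → z′≢x (path-of-length-one mid mid′ ends last (AllPairs.tail unique) z≡x′)

  comp-z-meets-N[x′] : ∀ {u} → comp z u ≡ true → T x′ u ≡ true → u ≡ z′
  comp-z-meets-N[x′] c x′u with z′-in-T_z (comp⇒Inner c)
  ... | zz′ , x′z′ = sym (x′-neighbour-unique x′z′ x′u (comp-trans (comp-sym zz′) c))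

  x′-root-avoids-N[x] : ∀ {r u} → T x′ r ≡ true → r ≢ z′ → comp r u ≡ true → T x u ≡ true → ⊥
  x′-root-avoids-N[x] {r} {u} x′r r≢z′ c xu with u ≟ z
  ... | no u≢z = x-neighbour-apart-x′-neighbour xu u≢z x′r c
  ... | yes refl = let (zz′ , x′z′) = z′-in-T_z (comp⇒Innerʳ c) in
    r≢z′ (x′-neighbour-unique x′r x′z′ (comp-trans c zz′))

  x-root-avoids-N[x′] : ∀ {r u} → T x r ≡ true → r ≢ z → comp r u ≡ true → T x′ u ≡ true → ⊥
  x-root-avoids-N[x′] xr r≢z c x′u = x-neighbour-apart-x′-neighbour xr r≢z x′u (comp-sym c)

  P₁ P₂ : Fin n → Bool
  P₁ v = T x v ∧ not (v == z) ∧ not (v == y)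
  P₂ v = T x′ v ∧ not (v == z′)

  P₁-true⁻ : ∀ {r} → P₁ r ≡ true → T x r ≡ true × r ≢ z × r ≢ y
  P₁-true⁻ {r} e = ∧-trueˡ e , not-==⁻ r z (∧-trueˡ rest) , not-==⁻ r y (∧-trueʳ {not (r == z)} rest)
    where rest = ∧-trueʳ {T x r} e

  P₂-true⁻ : ∀ {r} → P₂ r ≡ true → T x′ r ≡ true × r ≢ z′
  P₂-true⁻ {r} e = ∧-trueˡ e , not-==⁻ r z′ (∧-trueʳ {T x′ r} e)

  Owned : Fin n → Set
  Owned u = comp y u ≡ true ⊎ comp z u ≡ true
          ⊎ (Σ (Fin n) λ r → P₁ r ≡ true × comp r u ≡ true) ⊎ (Σ (Fin n) λ r → P₂ r ≡ true × comp r u ≡ true)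

  -- Follow a walk from x to u and look at where it last leaves {x, x′}.
  owned : ∀ {u} → Inner u → Owned u
  owned {u} u∉ with last-exit (Reach⇒Walk (proj₁ (proj₂ tree) x u)) u∉
  ... | inj₁ ((x≢x , _) , _) = ⊥-elim (x≢x refl)
  ... | inj₂ (_ , w , inj₁ refl , xw , wu) with w ≟ z | w ≟ y
  ...   | yes refl | _ = inj₂ (inj₁ wu)
  ...   | no _ | yes refl = inj₁ wu
  ...   | no w≢z | no w≢y = inj₂ (inj₂ (inj₁ (w , ∧-true xw (∧-true (not-==⁺ w z w≢z) (not-==⁺ w y w≢y)) , wu)))
  owned {u} u∉ | inj₂ (_ , w , inj₂ refl , x′w , wu) with w ≟ z′
  ... | no w≢z′ = inj₂ (inj₂ (inj₂ (w , ∧-true x′w (not-==⁺ w z′ w≢z′) , wu)))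
  ... | yes refl = inj₂ (inj₁ (comp-trans (proj₁ (z′-in-T_z (z-Inner (proj₁ (comp⇒Inner wu))))) wu))

  others-true⁻ : ∀ {u} → others x x′ u ≡ true → Inner u
  others-true⁻ {u} e = not-==⁻ u x (∧-trueˡ e) , not-==⁻ u x′ (∧-trueʳ {not (u == x)} e)

  others-true⁺ : ∀ {u} → Inner u → others x x′ u ≡ true
  others-true⁺ {u} (u≢x , u≢x′) = ∧-true (not-==⁺ u x u≢x) (not-==⁺ u x′ u≢x′)

  others-∖-components : ∀ D → others x x′ ∖ D ≗
    ⋃ P₁ (λ r → comp r ∖ D) ∪ ⋃ P₂ (λ r → comp r ∖ D) ∪ comp y ∖ D ∪ comp z ∖ D
  others-∖-components D u = Bool-ext to from
    where
    U₁ U₂ : Bool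
    U₁ = ⋃ P₁ (λ r → comp r ∖ D) u
    U₂ = ⋃ P₂ (λ r → comp r ∖ D) u
    to : (others x x′ ∖ D) u ≡ true → ((U₁ ∨ U₂) ∨ (comp y ∖ D) u) ∨ (comp z ∖ D) u ≡ true
    to e = by-owner (owned (others-true⁻ (∧-trueˡ e)))
      where
      D∌u = ∧-trueʳ {others x x′ u} e
      by-owner : Owned u → ((U₁ ∨ U₂) ∨ (comp y ∖ D) u) ∨ (comp z ∖ D) u ≡ true
      by-owner (inj₁ yu) = ∨-trueˡ (∨-trueʳ {U₁ ∨ U₂} (∧-true yu D∌u))
      by-owner (inj₂ (inj₁ zu)) = ∨-trueʳ {(U₁ ∨ U₂) ∨ _} (∧-true zu D∌u)
      by-owner (inj₂ (inj₂ (inj₁ (r , P₁r , ru)))) =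
        ∨-trueˡ (∨-trueˡ (∨-trueˡ (any-true⁺ (∈-allFin r) (∧-true P₁r (∧-true ru D∌u)))))
      by-owner (inj₂ (inj₂ (inj₂ (r , P₂r , ru)))) =
        ∨-trueˡ (∨-trueˡ (∨-trueʳ {U₁} (any-true⁺ (∈-allFin r) (∧-true P₂r (∧-true ru D∌u)))))
    in-others : ∀ {r} → (comp r ∖ D) u ≡ true → (others x x′ ∖ D) u ≡ true
    in-others {r} e = ∧-true (others-true⁺ (comp⇒Innerʳ (∧-trueˡ e))) (∧-trueʳ {comp r u} e)
    in-⋃ : ∀ {P} → ⋃ P (λ r → comp r ∖ D) u ≡ true → (others x x′ ∖ D) u ≡ true
    in-⋃ {P} e with any-true⁻ (allFin n) e
    ... | r , _ , PD = in-others (∧-trueʳ {P r} PD)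
    from : ((U₁ ∨ U₂) ∨ (comp y ∖ D) u) ∨ (comp z ∖ D) u ≡ true → (others x x′ ∖ D) u ≡ true
    from e with ∨-true⁻ {(U₁ ∨ U₂) ∨ _} e
    ... | inj₂ zD = in-others zD
    ... | inj₁ e′ with ∨-true⁻ {U₁ ∨ U₂} e′
    ...   | inj₂ yD = in-others yD
    ...   | inj₁ e″ with ∨-true⁻ {U₁} e″
    ...     | inj₁ u₁ = in-⋃ {P₁} u₁
    ...     | inj₂ u₂ = in-⋃ {P₂} u₂

  pieces-separated : ∀ D {a b} → (comp a b ≡ true → ⊥) → Separated T (comp a ∖ D) (comp b ∖ D)
  pieces-separated D ¬ab = Separated-⊆ (λ _ → ∧-trueˡ) (λ _ → ∧-trueˡ) (distinct-components-separated ¬ab)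

  decomposition : ∀ D → FInd T (others x x′ ∖ D) ≡
    prodOver P₁ (λ r → FInd T (comp r ∖ D)) * prodOver P₂ (λ r → FInd T (comp r ∖ D))
      * FInd T (comp y ∖ D) * FInd T (comp z ∖ D)
  decomposition D = begin
    FInd T (others x x′ ∖ D)
      ≡⟨ FInd-congʳ (others-∖-components D) ⟩
    FInd T (U₁ ∪ U₂ ∪ comp y ∖ D ∪ comp z ∖ D)
      ≡⟨ FInd-∪ simple (Separated-∪ˡ (Separated-∪ˡ P₁-z P₂-z) y-z) ⟩
    FInd T (U₁ ∪ U₂ ∪ comp y ∖ D) * FInd T (comp z ∖ D)
      ≡⟨ cong (_* _) (FInd-∪ simple (Separated-∪ˡ P₁-y P₂-y)) ⟩
    FInd T (U₁ ∪ U₂) * FInd T (comp y ∖ D) * FInd T (comp z ∖ D)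
      ≡⟨ cong (λ m → m * FInd T (comp y ∖ D) * FInd T (comp z ∖ D)) (FInd-∪ simple P₁-P₂) ⟩
    FInd T U₁ * FInd T U₂ * FInd T (comp y ∖ D) * FInd T (comp z ∖ D)
      ≡⟨ cong (λ m → m * FInd T (comp y ∖ D) * FInd T (comp z ∖ D))
              (cong₂ _*_ (FInd-⋃ simple P₁ _ P₁-P₁) (FInd-⋃ simple P₂ _ P₂-P₂)) ⟩
    prodOver P₁ (λ r → FInd T (comp r ∖ D)) * prodOver P₂ (λ r → FInd T (comp r ∖ D))
      * FInd T (comp y ∖ D) * FInd T (comp z ∖ D) ∎
    where
    open ≡-Reasoning
    U₁ = ⋃ P₁ (λ r → comp r ∖ D)
    U₂ = ⋃ P₂ (λ r → comp r ∖ D)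
    P₁-P₁ : ∀ r r′ → r ≢ r′ → P₁ r ≡ true → P₁ r′ ≡ true → Separated T (comp r ∖ D) (comp r′ ∖ D)
    P₁-P₁ r r′ r≢r′ P₁r P₁r′ =
      pieces-separated D (r≢r′ ∘ x-neighbour-unique (proj₁ (P₁-true⁻ P₁r)) (proj₁ (P₁-true⁻ P₁r′)))
    P₂-P₂ : ∀ r r′ → r ≢ r′ → P₂ r ≡ true → P₂ r′ ≡ true → Separated T (comp r ∖ D) (comp r′ ∖ D)
    P₂-P₂ r r′ r≢r′ P₂r P₂r′ =
      pieces-separated D (r≢r′ ∘ x′-neighbour-unique (proj₁ (P₂-true⁻ P₂r)) (proj₁ (P₂-true⁻ P₂r′)))
    P₂-avoids : ∀ {r a} → P₂ r ≡ true → T x a ≡ true → Separated T (comp r ∖ D) (comp a ∖ D)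
    P₂-avoids P₂r xa = let (x′r , r≢z′) = P₂-true⁻ P₂r in
      pieces-separated D λ c → x′-root-avoids-N[x] x′r r≢z′ c xa
    P₁-P₂ : Separated T U₁ U₂
    P₁-P₂ = Separated-⋃ˡ λ r P₁r →
      Separated-sym T-symmetric (Separated-⋃ˡ λ r′ P₂r′ → P₂-avoids P₂r′ (proj₁ (P₁-true⁻ P₁r)))
    P₁-y : Separated T U₁ (comp y ∖ D)
    P₁-y = Separated-⋃ˡ λ r P₁r → let (xr , _ , r≢y) = P₁-true⁻ P₁r in
      pieces-separated D (r≢y ∘ x-neighbour-unique xr x~y)
    P₂-y : Separated T U₂ (comp y ∖ D)
    P₂-y = Separated-⋃ˡ λ r P₂r → P₂-avoids P₂r x~y
    y-z : Separated T (comp y ∖ D) (comp z ∖ D)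
    y-z = pieces-separated D (y≢z ∘ x-neighbour-unique x~y x~z)
    P₁-z : Separated T U₁ (comp z ∖ D)
    P₁-z = Separated-⋃ˡ λ r P₁r → let (xr , r≢z , _) = P₁-true⁻ P₁r in
      pieces-separated D (r≢z ∘ x-neighbour-unique xr x~z)
    P₂-z : Separated T U₂ (comp z ∖ D)
    P₂-z = Separated-⋃ˡ λ r P₂r → P₂-avoids P₂r x~z

  decomposition-cong : ∀ D {f₁ f₂ : Fin n → Fin n → Bool} {gy gz : Fin n → Bool} →
    (∀ r → P₁ r ≡ true → comp r ∖ D ≗ f₁ r) → (∀ r → P₂ r ≡ true → comp r ∖ D ≗ f₂ r) →
    comp y ∖ D ≗ gy → comp z ∖ D ≗ gz →
    FInd T (others x x′ ∖ D) ≡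
      prodOver P₁ (λ r → FInd T (f₁ r)) * prodOver P₂ (λ r → FInd T (f₂ r)) * FInd T gy * FInd T gz
  decomposition-cong D e₁ e₂ ey ez = trans (decomposition D) (cong₂ _*_ (cong₂ _*_ (cong₂ _*_
    (prodOver-cong P₁ λ r P₁r → FInd-congʳ (e₁ r P₁r)) (prodOver-cong P₂ λ r P₂r → FInd-congʳ (e₂ r P₂r)))
    (FInd-congʳ ey)) (FInd-congʳ ez))

  X X̄ X′ X̄′ Y Ȳ k Z̄z Z̄z′ : ℕ
  X = prodOver P₁ (λ v → FInd T (comp v))
  X̄ = prodOver P₁ (λ v → FInd T (minusV (comp v) v))
  X′ = prodOver P₂ (λ v → FInd T (comp v))
  X̄′ = prodOver P₂ (λ v → FInd T (minusV (comp v) v))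
  Y = FInd T (comp y)
  Ȳ = FInd T (minusV (comp y) y)
  k = FInd T (minusV (comp y) y ∖ T y)
  Z̄z = FInd T (minusV (comp z) z)
  Z̄z′ = FInd T (minusV (comp z) z′)

  Y≡Ȳ+k : Y ≡ Ȳ + k
  Y≡Ȳ+k = FInd-delete T (comp y) y T-symmetric (proj₂ simple y) (comp-refl y-Inner)

  x-neighbour-piece : ∀ {r} → T x r ≡ true → ∀ u → comp r u ≡ true → T x u ≡ true → u ≡ r
  x-neighbour-piece xr u ru xu = sym (x-neighbour-unique xr xu ru)

  x′-neighbour-piece : ∀ {r} → T x′ r ≡ true → ∀ u → comp r u ≡ true → T x′ u ≡ true → u ≡ r
  x′-neighbour-piece x′r u ru x′u = sym (x′-neighbour-unique x′r x′u ru)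

  z′-in-N[x′] : comp z z′ ≡ true → T x′ z′ ≡ true
  z′-in-N[x′] zz′ = proj₂ (z′-in-T_z (comp⇒Inner zz′))

  T-term-N[x′] : FInd T (others x x′ ∖ T x′) ≡ X * X̄′ * Y * Z̄z′
  T-term-N[x′] = decomposition-cong (T x′)
    (λ r P₁r → let (xr , r≢z , _) = P₁-true⁻ P₁r in ∖-disjoint λ u → x-root-avoids-N[x′] xr r≢z)
    (λ r P₂r → let (x′r , _) = P₂-true⁻ P₂r in ∖-single (x′-neighbour-piece x′r) (λ _ → x′r))
    (∖-disjoint λ u → x-root-avoids-N[x′] x~y y≢z)
    (∖-single (λ u → comp-z-meets-N[x′]) z′-in-N[x′])

  T-term-N[x] : FInd T (others x x′ ∖ T x) ≡ X̄ * X′ * Ȳ * Z̄z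
  T-term-N[x] = decomposition-cong (T x)
    (λ r P₁r → let (xr , _) = P₁-true⁻ P₁r in ∖-single (x-neighbour-piece xr) (λ _ → xr))
    (λ r P₂r → let (x′r , r≢z′) = P₂-true⁻ P₂r in ∖-disjoint λ u → x′-root-avoids-N[x] x′r r≢z′)
    (∖-single (x-neighbour-piece x~y) (λ _ → x~y))
    (∖-single (x-neighbour-piece x~z) (λ _ → x~z))

  ρ-term-N[x′] : FInd T (others x x′ ∖ ((_== y) ∪ T x′)) ≡ X * X̄′ * Ȳ * Z̄z′
  ρ-term-N[x′] = decomposition-cong ((_== y) ∪ T x′)
    (λ r P₁r → let (xr , r≢z , r≢y) = P₁-true⁻ P₁r in ∖-disjoint λ u ru → by-cases u
      (λ { refl → r≢y (x-neighbour-unique xr x~y ru) }) (x-root-avoids-N[x′] xr r≢z ru))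
    (λ r P₂r → let (x′r , r≢z′) = P₂-true⁻ P₂r in ∖-single (λ u ru → by-cases u
      (λ { refl → ⊥-elim (x′-root-avoids-N[x] x′r r≢z′ ru x~y) }) (x′-neighbour-piece x′r u ru))
      (λ _ → ∨-trueʳ {r == y} x′r))
    (∖-single (λ u yu → by-cases u (λ u≡y → u≡y) (⊥-elim ∘ x-root-avoids-N[x′] x~y y≢z yu))
      (λ _ → ∨-trueˡ (==-refl y)))
    (∖-single (λ u zu → by-cases u (λ { refl → ⊥-elim (y≢z (x-neighbour-unique x~y x~z (comp-sym zu))) })
      (comp-z-meets-N[x′] zu)) (λ zz′ → ∨-trueʳ {z′ == y} (z′-in-N[x′] zz′)))
    where
    by-cases : ∀ {B : Set} u → (u ≡ y → B) → (T x′ u ≡ true → B) → ((_== y) ∪ T x′) u ≡ true → B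
    by-cases u on-y on-N[x′] e = [ on-y ∘ ==-true⁻ u y , on-N[x′] ]′ (∨-true⁻ {u == y} e)

  ρ-term-N[x] : FInd T (others x x′ ∖ (T x ∖ (_== y))) ≡ X̄ * X′ * Y * Z̄z
  ρ-term-N[x] = decomposition-cong (T x ∖ (_== y))
    (λ r P₁r → let (xr , _ , r≢y) = P₁-true⁻ P₁r in
      ∖-single (λ u ru → x-neighbour-piece xr u ru ∘ ∧-trueˡ) (λ _ → ∧-true xr (not-==⁺ r y r≢y)))
    (λ r P₂r → let (x′r , r≢z′) = P₂-true⁻ P₂r in ∖-disjoint λ u ru → x′-root-avoids-N[x] x′r r≢z′ ru ∘ ∧-trueˡ)
    (∖-disjoint λ u yu e → not-==⁻ u y (∧-trueʳ {T x u} e) (x-neighbour-piece x~y u yu (∧-trueˡ e)))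
    (∖-single (λ u zu → x-neighbour-piece x~z u zu ∘ ∧-trueˡ) (λ _ → ∧-true x~z (not-==⁺ z y (≢-sym y≢z))))

  ρ : Graph n
  ρ = rho T x y x′

  ρ-agrees : ∀ {u v} → Inner u → Inner v → ρ u v ≡ T u v
  ρ-agrees {u} {v} (u≢x , u≢x′) (v≢x , v≢x′)
    rewrite ==-false u x u≢x | ==-false u x′ u≢x′ | ==-false v x v≢x | ==-false v x′ v≢x′
    with u == y | v == y
  ... | true | true = refl
  ... | true | false = refl
  ... | false | true = refl
  ... | false | false = refl

  ρ-x : ∀ u → ρ x u ≡ (T x ∖ (_== y)) u
  ρ-x u rewrite ==-false x y (≢-sym (proj₁ y-Inner)) | ==-false x x′ (≢-sym x′≢x) | ==-refl x with u == y
  ... | true = sym (∧-zeroʳ (T x u))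
  ... | false = sym (∧-identityʳ (T x u))

  ρ-x′ : ∀ u → ρ x′ u ≡ ((_== y) ∪ T x′) u
  ρ-x′ u rewrite ==-false x′ y (≢-sym y≢x′) | ==-false x′ x x′≢x | ==-refl x′ with u == y
  ... | true = refl
  ... | false = refl

  ρ-N[x]∪N[x′] : ∀ u → ρ x u ∨ ρ x′ u ≡ T x u ∨ T x′ u
  ρ-N[x]∪N[x′] u rewrite ρ-x u | ρ-x′ u with u ≟ y
  ... | yes refl rewrite x~y = refl
  ... | no _ = cong (_∨ T x′ u) (∧-identityʳ (T x u))

  FInd-ρ : ∀ {S S′} → S ⊆ others x x′ → S ≗ S′ → FInd ρ S ≡ FInd T S′
  FInd-ρ S⊆ = FInd-cong λ u v Su Sv → ρ-agrees (others-true⁻ (S⊆ u Su)) (others-true⁻ (S⊆ v Sv))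

  FInd-ρ-others∖ : ∀ {D D′} → D ≗ D′ → FInd ρ (others x x′ ∖ D) ≡ FInd T (others x x′ ∖ D′)
  FInd-ρ-others∖ D≗D′ = FInd-ρ (λ _ → ∧-trueˡ) (λ u → cong (λ b → others x x′ u ∧ not b) (D≗D′ u))

  F₀ F₂ : ℕ
  F₀ = FInd T (others x x′)
  F₂ = if T x x′ then 0 else FInd T (others x x′ ∖ (T x ∪ T x′))

  F-T : F T ≡ F₀ + X * X̄′ * (Ȳ + k) * Z̄z′ + X̄ * X′ * Ȳ * Z̄z + F₂
  F-T = trans (FInd-expand-pair T simple x′≢x) (cong (λ m → m + F₂) (cong₂ _+_
    (cong (F₀ +_) (trans T-term-N[x′] (cong (λ m → X * X̄′ * m * Z̄z′) Y≡Ȳ+k))) T-term-N[x]))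

  F-ρ : F ρ ≡ F₀ + X * X̄′ * Ȳ * Z̄z′ + X̄ * X′ * (Ȳ + k) * Z̄z + F₂
  F-ρ = trans (FInd-expand-pair ρ (rho-simple simple y≢x′) x′≢x)
    (cong₂ _+_ (cong₂ _+_ (cong₂ _+_ base N[x′]-term) N[x]-term) both-term)
    where
    base : FInd ρ (others x x′) ≡ F₀
    base = FInd-ρ (λ _ e → e) (λ _ → refl)
    N[x′]-term : FInd ρ (others x x′ ∖ ρ x′) ≡ X * X̄′ * Ȳ * Z̄z′
    N[x′]-term = trans (FInd-ρ-others∖ ρ-x′) ρ-term-N[x′]
    N[x]-term : FInd ρ (others x x′ ∖ ρ x) ≡ X̄ * X′ * (Ȳ + k) * Z̄z
    N[x]-term = trans (FInd-ρ-others∖ ρ-x) (trans ρ-term-N[x] (cong (λ m → X̄ * X′ * m * Z̄z) Y≡Ȳ+k))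
    ρxx′ : ρ x x′ ≡ T x x′
    ρxx′ = trans (ρ-x x′) (trans (cong (λ b → T x x′ ∧ not b) (==-false x′ y (≢-sym y≢x′))) (∧-identityʳ _))
    both-term : (if ρ x x′ then 0 else FInd ρ (others x x′ ∖ (ρ x ∪ ρ x′))) ≡ F₂
    both-term = cong₂ (λ b m → if b then 0 else m) ρxx′ (FInd-ρ-others∖ ρ-N[x]∪N[x′])

lemma5 : ∀ {n} (T : Graph n) (x y x' z z' : Fin n) (comp : Fin n → Fin n → Bool) →
  IsTree T → T x y ≡ true → x' ≢ x → Reach (deleteEdge T x y) x x' →
  (Σ (List (Fin n)) λ ps → Σ (List (Fin n)) λ mid → Σ (List (Fin n)) λ mid' →
    IsPath T x x' ps × (ps ≡ x ∷ z ∷ mid) × (ps ≡ mid' ++ (z' ∷ x' ∷ []))) →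
  (∀ v u → v ≢ x → v ≢ x' → (comp v u ≡ true ⇔ Reach (deleteVertices T x x') v u)) →
  (∀ v u → (v ≡ x ⊎ v ≡ x') → comp v u ≡ false) →
  let X = prodOver (λ v → T x v ∧ not (v == z) ∧ not (v == y)) (λ v → FInd T (comp v))
      Xb = prodOver (λ v → T x v ∧ not (v == z) ∧ not (v == y)) (λ v → FInd T (minusV (comp v) v))
      X' = prodOver (λ v → T x' v ∧ not (v == z')) (λ v → FInd T (comp v))
      Xb' = prodOver (λ v → T x' v ∧ not (v == z')) (λ v → FInd T (minusV (comp v) v))
      Zz = FInd T (minusV (comp z) z)
      Zz' = FInd T (minusV (comp z) z')
  in (F (rho T x y x') < F T) ⇔ (X * Xb' * Zz' > Xb * X' * Zz)
lemma5 T x y x′ z z′ comp tree x~y x′≢x x⇝x′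
  (_ , mid , mid′ , (_ , refl , last , walk , unique) , refl , ends) comp⇔ comp-outside =
  subst₂ (λ m m′ → (m < m′) ⇔ (X̄ * X′ * Z̄z < X * X̄′ * Z̄z′)) (sym F-ρ) (sym F-T)
    (exchange-< F₀ F₂ (X * X̄′) Z̄z′ (X̄ * X′) Z̄z Ȳ k (FInd-positive T _))
  where open Rotation tree comp x~y x′≢x x⇝x′ walk unique last ends comp⇔ comp-outside
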